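{- Let $t$ be an infinite frieze with quiddity sequence $(a_i)_{i\in\mathbb{Z}}$. If $t$ has enough ones, then $a_i=1$ for some $i\in\mathbb{Z}$.
   Context: An infinite frieze is a map $t:\mathbb{Z}\times\mathbb{Z}\to\mathbb{Z}$ with $t(i,i)=0$; $t(i,j)\ge1$ for $i<j$ and $t(i,i+1)=1$; $t(i,j)=-t(j,i)$; and $t(i,j)t(i+1,j+1)-t(i,j+1)t(i+1,j)=1$ for all $i,j$. Its quiddity sequence is $a_i=t(i-1,i+1)$. It has enough ones if for all $i\le j$ there exist $i'\le i\le j\le j'$ with $t(i',j')=1$. -}

module Defs where

open import Data.Integer using (ℤ; +_; -_; _+_; _-_; _*_; _≤_; _<_)
open import Data.Product using (Σ; _×_; ∃; ∃-syntax; _,_)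
open import Relation.Binary.PropositionalEquality using (_≡_)

record IsInfiniteFrieze (t : ℤ → ℤ → ℤ) : Set where
  field
    diag      : ∀ i → t i i ≡ + 0
    positive  : ∀ i j → i < j → + 1 ≤ t i j
    adjacent  : ∀ i → t i (i + + 1) ≡ + 1
    antisym   : ∀ i j → t i j ≡ - t j i
    diamond   : ∀ i j →
      t i j * t (i + + 1) (j + + 1) - t i (j + + 1) * t (i + + 1) j ≡ + 1

quiddity : (ℤ → ℤ → ℤ) → ℤ → ℤ
quiddity t i = t (i - + 1) (i + + 1)

HasEnoughOnes : (ℤ → ℤ → ℤ) → Set
HasEnoughOnes t =
  ∀ i j → i ≤ j → ∃[ i' ] ∃[ j' ] (i' ≤ i × j ≤ j' × t i' j' ≡ + 1)

module Submission where

-- Fix a row index i of an infinite frieze t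
-- and read the entries u n = t(i, i+n) along it.  The diamond rule forces
-- the linear recurrence
--     u n + u (n+2) = a_{i+n+1} · u (n+1),
-- with u 0 = 0 and u 1 = 1 (the row recurrence: its defect satisfies a
-- Wronskian identity and vanishes on the diagonal, hence everywhere).
-- A positive sequence with such a recurrence whose coefficients are all
-- ≥ 2 is strictly increasing, so it can never come back to the value 1.
-- Hence, if t(i, i+m+2) = 1, some quiddity coefficient a_k equals 1.
-- "Enough ones" supplies such an entry t(i', j') = 1 with j' ≥ i' + 2.

open import Defs
open import Data.Integer using (ℤ; +_)
open import Data.Product using (∃; ∃-syntax)
open import Relation.Binary.PropositionalEquality using (_≡_)

open import Data.Integer using (_+_; _-_; _*_; _≤_; _<_; +≤+; +<+; ∣_∣; nonNegative)
open import Data.Integer.Properties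
open import Data.Integer.Tactic.RingSolver using (solve-∀)
open import Data.Nat using (ℕ; zero; suc; z≤n; z<s)
open import Data.Product using (_,_; map)
open import Data.Sum using (_⊎_; inj₁; inj₂)
open import Function using (id; _∘_)
open import Relation.Nullary using (yes; no; contradiction)
open import Relation.Binary.PropositionalEquality using (refl; sym; trans; cong; cong₂; subst; module ≡-Reasoning)

wronskian-identity : ∀ p q r p' q' r' a →
  (p + r - a * q) * q' - q * (p' + r' - a * q') ≡ (p * q' - q * p') - (q * r' - r * q')
wronskian-identity = solve-∀

diagonal-identity : ∀ A → + 0 + A - A * + 1 ≡ + 0
diagonal-identity = solve-∀

increment-identity : ∀ u₀ u₁ u₂ c →
  u₂ - u₁ ≡ ((u₁ - u₀) + (c - + 2) * u₁) + ((u₀ + u₂) - c * u₁)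
increment-identity = solve-∀

sub-add-cancel : ∀ a x → (a - x) + x ≡ a
sub-add-cancel = solve-∀

succ-pred : ∀ k → (k + + 1) - + 1 ≡ k
succ-pred = solve-∀

add-sub-cancel : ∀ i j → i + (j - i) ≡ j
add-sub-cancel = solve-∀

offset-suc : ∀ i n → i + + suc n ≡ (i + + n) + + 1
offset-suc i n = trans (cong (λ x → i + x) (+-comm (+ 1) (+ n))) (sym (+-assoc i (+ n) (+ 1)))

≤⇒<+1 : ∀ {x y} → x ≤ y → x < y + + 1
≤⇒<+1 {x} {y} x≤y = subst (_< y + + 1) (+-identityʳ x) (+-mono-≤-< x≤y (+<+ z<s))

difference-bound : ∀ {a x} → + 1 ≤ a - x → x < a
difference-bound {a} {x} h =
  suc[i]≤j⇒i<j (subst (+ 1 + x ≤_) (sub-add-cancel a x) (+-monoˡ-≤ x h))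

cancel-positive : ∀ x q → + 1 ≤ q → x * q ≡ + 0 → x ≡ + 0
cancel-positive x q 1≤q xq≡0 with i*j≡0⇒i≡0∨j≡0 x xq≡0
... | inj₁ x≡0 = x≡0
... | inj₂ refl with 1≤q
... | +≤+ ()

gap-as-offset : ∀ i j → i + + 2 ≤ j → ∃[ m ] i + + suc (suc m) ≡ j
gap-as-offset i j i+2≤j = ∣ j - (i + + 2) ∣ , (begin
    i + (+ 2 + + ∣ j - (i + + 2) ∣)  ≡⟨ cong (λ x → i + (+ 2 + x)) (0≤i⇒+∣i∣≡i (i≤j⇒0≤j-i i+2≤j)) ⟩
    i + (+ 2 + (j - (i + + 2)))      ≡⟨ sym (+-assoc i (+ 2) _) ⟩
    (i + + 2) + (j - (i + + 2))      ≡⟨ add-sub-cancel (i + + 2) j ⟩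
    j                                ∎)
  where open ≡-Reasoning

module GrowingSequence
  (u c : ℕ → ℤ)
  (u-zero : u 0 ≡ + 0)
  (u-one : u 1 ≡ + 1)
  (u-positive : ∀ n → + 1 ≤ u (suc n))
  (c-positive : ∀ n → + 1 ≤ c n)
  (recurrence : ∀ n → u n + u (suc (suc n)) ≡ c n * u (suc n))
  where

  SomeCoefficientIsOne : Set
  SomeCoefficientIsOne = ∃[ m ] c m ≡ + 1

  -- Unless a coefficient equals 1, every step increases u by at least 1:
  -- u(n+2) - u(n+1) = (u(n+1) - u n) + (c n - 2) · u(n+1).
  increment : ∀ n → SomeCoefficientIsOne ⊎ (+ 1 ≤ u (suc n) - u n)
  increment zero rewrite u-zero | u-one = inj₂ ≤-refl
  increment (suc n) with increment n | c n ≟ + 1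
  ... | inj₁ one | _ = inj₁ one
  ... | inj₂ _ | yes cₙ≡1 = inj₁ (n , cₙ≡1)
  ... | inj₂ step≥1 | no cₙ≢1 =
    inj₂ (subst (+ 1 ≤_) (sym next-step) (≤-trans step≥1 (i≤i+j _ _ {{nonNegative surplus≥0}})))
    where
    cₙ≥2 : + 2 ≤ c n
    cₙ≥2 = i<j⇒suc[i]≤j (≤∧≢⇒< (c-positive n) (cₙ≢1 ∘ sym))

    surplus≥0 : + 0 ≤ (c n - + 2) * u (suc n)
    surplus≥0 = *-monoʳ-≤-nonNeg (u (suc n)) {{nonNegative (≤-trans (+≤+ z≤n) (u-positive n))}}
                  (i≤j⇒0≤j-i cₙ≥2)

    next-step : u (suc (suc n)) - u (suc n) ≡ (u (suc n) - u n) + (c n - + 2) * u (suc n)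
    next-step = begin
      u (suc (suc n)) - u (suc n)
        ≡⟨ increment-identity (u n) (u (suc n)) (u (suc (suc n))) (c n) ⟩
      ((u (suc n) - u n) + (c n - + 2) * u (suc n)) + ((u n + u (suc (suc n))) - c n * u (suc n))
        ≡⟨ cong (λ x → ((u (suc n) - u n) + (c n - + 2) * u (suc n)) + x) (i≡j⇒i-j≡0 (recurrence n)) ⟩
      ((u (suc n) - u n) + (c n - + 2) * u (suc n)) + + 0
        ≡⟨ +-identityʳ _ ⟩
      (u (suc n) - u n) + (c n - + 2) * u (suc n) ∎
      where open ≡-Reasoning

  -- A later term equal to 1 forces a coefficient equal to 1, since
  -- otherwise u(n+2) ≥ u(n+1) + 1 ≥ 2.
  never-returns-to-one : ∀ n → u (suc (suc n)) ≡ + 1 → SomeCoefficientIsOne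
  never-returns-to-one n uₙ₊₂≡1 with increment (suc n)
  ... | inj₁ one = one
  ... | inj₂ step≥1 =
    contradiction (≤-<-trans (u-positive n) (difference-bound (subst (λ v → + 1 ≤ v - u (suc n)) uₙ₊₂≡1 step≥1)))
      (<-irrefl refl)

module FriezeRows (t : ℤ → ℤ → ℤ) (F : IsInfiniteFrieze t) where
  open IsInfiniteFrieze F

  next : ℤ → ℤ
  next k = k + + 1

  quiddity-next : ∀ k → quiddity t (next k) ≡ t k (next (next k))
  quiddity-next k = cong (λ x → t x (next (next k))) (succ-pred k)

  positive-right-of : ∀ i k → i ≤ k → + 1 ≤ t i (next k)
  positive-right-of i k i≤k = positive i (next k) (≤⇒<+1 i≤k)

  positive-offset : ∀ i n → + 1 ≤ t i (i + + suc n)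
  positive-offset i n = subst (λ j → + 1 ≤ t i j) (sym (offset-suc i n))
                          (positive-right-of i (i + + n) (i≤i+j i (+ n)))

  defect : ℤ → ℤ → ℤ
  defect i k = t i k + t i (next (next k)) - t k (next (next k)) * t i (next k)

  -- The diamond rules at (i,k) and (i,k+1), both equal to 1, cancel.
  defect-wronskian : ∀ i k →
    defect i k * t (next i) (next k) - t i (next k) * defect (next i) k ≡ + 0
  defect-wronskian i k = trans
    (wronskian-identity (t i k) (t i (next k)) (t i (next (next k)))
                        (t (next i) k) (t (next i) (next k)) (t (next i) (next (next k)))
                        (t k (next (next k))))
    (cong₂ _-_ (diamond i k) (diamond i (next k)))

  defect-diagonal : ∀ i → defect i i ≡ + 0
  defect-diagonal i rewrite diag i | adjacent i = diagonal-identity (t i (next (next i)))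

  defect-propagates : ∀ i k → + 1 ≤ t (next i) (next k) →
    defect (next i) k ≡ + 0 → defect i k ≡ + 0
  defect-propagates i k pos below≡0 = cancel-positive (defect i k) (t (next i) (next k)) pos (begin
    D * q                           ≡⟨ sym (+-identityʳ (D * q)) ⟩
    D * q - + 0                     ≡⟨ cong (λ x → D * q - x) (sym (*-zeroʳ (t i (next k)))) ⟩
    D * q - t i (next k) * + 0      ≡⟨ cong (λ x → D * q - t i (next k) * x) (sym below≡0) ⟩
    D * q - t i (next k) * defect (next i) k ≡⟨ defect-wronskian i k ⟩
    + 0                             ∎)
    where
    open ≡-Reasoning
    D = defect i k
    q = t (next i) (next k)

  defect-vanishes : ∀ n i k → i + + n ≡ k → defect i k ≡ + 0
  defect-vanishes zero i k i+0≡k with trans (sym (+-identityʳ i)) i+0≡k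
  ... | refl = defect-diagonal i
  defect-vanishes (suc m) i k i+n≡k =
    defect-propagates i k (positive-right-of (next i) k next-i≤k)
      (defect-vanishes m (next i) k next-i+m≡k)
    where
    next-i+m≡k : next i + + m ≡ k
    next-i+m≡k = trans (+-assoc i (+ 1) (+ m)) i+n≡k
    next-i≤k : next i ≤ k
    next-i≤k = subst (next i ≤_) next-i+m≡k (i≤i+j (next i) (+ m))

  row : ℤ → ℕ → ℤ
  row i n = t i (i + + n)

  coefficient : ℤ → ℕ → ℤ
  coefficient i n = quiddity t (next (i + + n))

  row-recurrence : ∀ i n →
    row i n + row i (suc (suc n)) ≡ coefficient i n * row i (suc n)
  row-recurrence i n = begin
    t i k + t i (i + + suc (suc n))          ≡⟨ cong (λ j → t i k + t i j) two-steps ⟩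
    t i k + t i (next (next k))              ≡⟨ i-j≡0⇒i≡j _ _ (defect-vanishes n i k refl) ⟩
    t k (next (next k)) * t i (next k)       ≡⟨ cong₂ _*_ (sym (quiddity-next k)) (cong (t i) (sym (offset-suc i n))) ⟩
    quiddity t (next k) * t i (i + + suc n)  ∎
    where
    open ≡-Reasoning
    k = i + + n
    two-steps : i + + suc (suc n) ≡ next (next k)
    two-steps = trans (offset-suc i (suc n)) (cong next (offset-suc i n))

  one-forces-quiddity-one : ∀ i m → t i (i + + suc (suc m)) ≡ + 1 →
    ∃[ k ] quiddity t k ≡ + 1
  one-forces-quiddity-one i m one =
    map (λ n → next (i + + n)) id (never-returns-to-one m one)
    where
    open GrowingSequence (row i) (coefficient i)
      (trans (cong (t i) (+-identityʳ i)) (diag i)) (adjacent i) (positive-offset i)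
      (λ n → subst (+ 1 ≤_) (sym (quiddity-next (i + + n)))
               (positive-right-of (i + + n) (next (i + + n)) (i≤i+j (i + + n) (+ 1))))
      (row-recurrence i)

corollary3p10 : (t : ℤ → ℤ → ℤ) → IsInfiniteFrieze t → HasEnoughOnes t →
    ∃[ i ] quiddity t i ≡ + 1
corollary3p10 t F enough-ones with enough-ones (+ 0) (+ 2) (+≤+ z≤n)
... | i , j , i≤0 , 2≤j , tij≡1 with gap-as-offset i j (≤-trans (+-monoˡ-≤ (+ 2) i≤0) 2≤j)
... | m , refl = FriezeRows.one-forces-quiddity-one t F i m tij≡1
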